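{- Let $D$ be the shadow, on the $2$-sphere $S^2$, of the standard $4$-crossing (minimal crossing) diagram of the figure-eight knot. Then for every connected smoothed state of $D$ taken as the starting game board, if Player C moves second in the Region Smoothing Swap Game, Player C has a winning strategy.
   Context: A link shadow is a link diagram on a closed surface $S$ with over/under information omitted at its crossings (called precrossings); it is assumed connected, and the components of the complement of the shadow in $S$ are called regions. Each precrossing can be smoothed in one of two ways (replacing the crossing by two non-crossing arcs). A choice of smoothing at every precrossing is a smoothed state; it is a collection of disjoint simple closed curves on $S$, and is called connected if it consists of exactly one closed curve. A region smoothing swap at a region $r$ replaces the smoothing at every precrossing on the boundary of $r$ by the other smoothing. The Region Smoothing Swap Game: start from a connected smoothed state (the game board). Two players, C and D, alternate turns; on a turn the player selects a region not selected before and either performs the region smoothing swap at it or leaves the state unchanged. The game ends when every region has been selected exactly once. Player C wins if the final smoothed state is connected; otherwise Player D wins. -}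

module Defs where

open import Data.Bool using (Bool; true; false; not; if_then_else_; _xor_)
open import Data.Nat using (ℕ; zero; suc)
open import Data.Fin using (Fin; zero; suc)
open import Data.Fin.Subset using (Subset; _∉_; ⁅_⁆; _∪_)
open import Data.Vec using (Vec; []; _∷_; lookup)
open import Data.Product using (_×_; _,_; ∃-syntax; Σ-syntax)
open import Data.Sum using (_⊎_)
open import Relation.Binary.PropositionalEquality using (_≡_)

-- Combinatorial (PD-code) description, taken from the KnotInfo PD code of
-- 4_1:  X[4,2,5,1] X[8,6,1,5] X[6,3,7,4] X[2,7,3,8].
-- Precrossings are Fin 4; at each precrossing the four incident
-- half-edges ("slots") are Fin 4, listed in counterclockwise order.
-- Over/under information is irrelevant (it is a shadow).

Precrossing : Set
Precrossing = Fin 4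

HalfEdge : Set
HalfEdge = Precrossing × Fin 4

pattern c0 = zero
pattern c1 = suc zero
pattern c2 = suc (suc zero)
pattern c3 = suc (suc (suc zero))

-- The other end of the edge of the shadow starting at a half-edge
-- (the two occurrences of the same edge label in the PD code).
otherEnd : HalfEdge → HalfEdge
otherEnd (c0 , c0) = (c2 , c3)
otherEnd (c0 , c1) = (c3 , c0)
otherEnd (c0 , c2) = (c1 , c3)
otherEnd (c0 , c3) = (c1 , c2)
otherEnd (c1 , c0) = (c3 , c3)
otherEnd (c1 , c1) = (c2 , c0)
otherEnd (c1 , c2) = (c0 , c3)
otherEnd (c1 , c3) = (c0 , c2)
otherEnd (c2 , c0) = (c1 , c1)
otherEnd (c2 , c1) = (c3 , c2)
otherEnd (c2 , c2) = (c3 , c1)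
otherEnd (c2 , c3) = (c0 , c0)
otherEnd (c3 , c0) = (c0 , c1)
otherEnd (c3 , c1) = (c2 , c2)
otherEnd (c3 , c2) = (c2 , c1)
otherEnd (c3 , c3) = (c1 , c0)

-- Regions of S² ∖ D (6 of them: Euler characteristic 4 - 8 + 6 = 2),
-- each given by the set of precrossings on its boundary (obtained by
-- face-tracing the ribbon structure above):
--   r0 = {0,1,2}, r1 = {0,2,3}, r2 = {0,1,3}, r3 = {0,1},
--   r4 = {1,2,3}, r5 = {2,3}.
Region : Set
Region = Fin 6

boundary : Region → Subset 4
boundary zero                                = true  ∷ true  ∷ true  ∷ false ∷ []
boundary (suc zero)                          = true  ∷ false ∷ true  ∷ true  ∷ []
boundary (suc (suc zero))                    = true  ∷ true  ∷ false ∷ true  ∷ []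
boundary (suc (suc (suc zero)))              = true  ∷ true  ∷ false ∷ false ∷ []
boundary (suc (suc (suc (suc zero))))        = false ∷ true  ∷ true  ∷ true  ∷ []
boundary (suc (suc (suc (suc (suc zero))))) = false ∷ false ∷ true  ∷ true  ∷ []

-- At a precrossing with slots 0,1,2,3 (ccw order), the
-- two smoothings are: false ↦ arcs joining slots {0,1} and {2,3};
--                     true  ↦ arcs joining slots {1,2} and {3,0}.

State : Set
State = Precrossing → Bool

smoothArc : Bool → Fin 4 → Fin 4
smoothArc false c0 = c1
smoothArc false c1 = c0
smoothArc false c2 = c3
smoothArc false c3 = c2
smoothArc true  c0 = c3
smoothArc true  c1 = c2
smoothArc true  c2 = c1
smoothArc true  c3 = c0

smoothStep : State → HalfEdge → HalfEdge
smoothStep s (c , i) = (c , smoothArc (s c) i)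

walk : State → ℕ → HalfEdge
walk s zero    = (c0 , c0)
walk s (suc n) = smoothStep s (otherEnd (walk s n))

-- A smoothed state is connected iff it consists of exactly one closed
-- curve, i.e. the curve through half-edge (0,0) passes through every
-- half-edge (every state curve passes through some half-edge).
Connected : State → Set
Connected s = ∀ (h : HalfEdge) → ∃[ n ] (walk s n ≡ h ⊎ otherEnd (walk s n) ≡ h)

swap : Region → State → State
swap r s c = s c xor lookup (boundary r) c

data Player : Set where
  playerC playerD : Player

other : Player → Player
other playerC = playerD
other playerD = playerC

applyMove : Region → Bool → State → State
applyMove r b s = if b then swap r s else s

CWins : ℕ → Player → Subset 6 → State → Set
CWins zero    _       sel s = Connected s
CWins (suc k) playerC sel s =
  Σ[ r ∈ Region ] (r ∉ sel × Σ[ b ∈ Bool ] CWins k playerD (⁅ r ⁆ ∪ sel) (applyMove r b s))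
CWins (suc k) playerD sel s =
  ∀ (r : Region) → r ∉ sel → ∀ (b : Bool) → CWins k playerC (⁅ r ⁆ ∪ sel) (applyMove r b s)

{-# OPTIONS --safe #-}
module Submission where

open import Defs
open import Data.Bool using (Bool; true; false; T; not; _∧_; _∨_; _xor_)
open import Data.Bool.ListAction using (any; all)
open import Data.Bool.Properties using (T-∧; T-∨; T-≡)
open import Data.Empty using (⊥-elim)
open import Data.Fin using (Fin)
open import Data.Fin.Properties using (_≟_)
open import Data.Fin.Subset using (Subset; ⊥; _∉_; ⁅_⁆; _∪_)
open import Data.List using (allFin)
open import Data.List.Membership.Propositional.Properties using (∈-allFin)
import Data.List.Relation.Unary.All as All
open import Data.List.Relation.Unary.All.Properties using (all⁺)
open import Data.List.Relation.Unary.Any using (satisfied)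
open import Data.List.Relation.Unary.Any.Properties using (any⁻)
open import Data.Nat using (ℕ; zero; suc)
open import Data.Product using (_,_; proj₁; proj₂; ∃-syntax)
open import Data.Sum using (_⊎_; inj₁; inj₂)
open import Data.Vec using (_∷_; []; lookup)
open import Data.Vec.Properties using (lookup∘tabulate; []=⇒lookup; lookup⇒[]=)
open import Function.Bundles using (Equivalence)
open import Relation.Nullary.Decidable using (⌊_⌋; toWitness)
open import Relation.Binary.PropositionalEquality using (_≡_; refl; cong; cong₂; subst; _≗_)

-- The game is finite: the board is one of 2⁴ smoothed states, and a play
-- orders the 6 regions with a swap/keep bit for each.  So Player C's winning
-- positions can be computed by evaluating the game tree, certifying
-- connectivity at the leaves by following the state curve through
-- half-edge (0,0) for 8 steps: a connected state curve runs once along each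
-- of the 8 edges, and each step covers both half-edges of one edge.

any-Fin : ∀ {n} → (Fin n → Bool) → Bool
any-Fin p = any p (allFin _)

all-Fin : ∀ {n} → (Fin n → Bool) → Bool
all-Fin p = all p (allFin _)

T-any-Fin⇒∃ : ∀ {n} (p : Fin n → Bool) → T (any-Fin p) → ∃[ i ] T (p i)
T-any-Fin⇒∃ p t = satisfied (any⁻ p (allFin _) t)

T-all-Fin⇒∀ : ∀ {n} (p : Fin n → Bool) → T (all-Fin p) → ∀ i → T (p i)
T-all-Fin⇒∀ p t i = All.lookup (all⁺ p (allFin _) t) (∈-allFin i)

T-∧-select : ∀ (f : Bool → Bool) b → T (f false ∧ f true) → T (f b)
T-∧-select f false t = proj₁ (Equivalence.to (T-∧ {f false}) t)
T-∧-select f true  t = proj₂ (Equivalence.to (T-∧ {f false}) t)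

T-∨-resolveˡ : ∀ {x y} → x ≡ false → T (x ∨ y) → T y
T-∨-resolveˡ refl t = t

T-not-lookup⇒∉ : ∀ {n} (sel : Subset n) r → T (not (lookup sel r)) → r ∉ sel
T-not-lookup⇒∉ sel r t r∈sel = subst (λ x → T (not x)) ([]=⇒lookup r∈sel) t

∉⇒lookup≡false : ∀ {n} (sel : Subset n) r → r ∉ sel → lookup sel r ≡ false
∉⇒lookup≡false sel r r∉sel with lookup sel r in eq
... | true  = ⊥-elim (r∉sel (lookup⇒[]= r sel eq))
... | false = refl

_==ʰ_ : HalfEdge → HalfEdge → Bool
(c , i) ==ʰ (c′ , i′) = ⌊ c ≟ c′ ⌋ ∧ ⌊ i ≟ i′ ⌋

T-==ʰ⇒≡ : ∀ h h′ → T (h ==ʰ h′) → h ≡ h′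
T-==ʰ⇒≡ (c , i) (c′ , i′) t with Equivalence.to (T-∧ {⌊ c ≟ c′ ⌋}) t
... | c≡c′ , i≡i′ = cong₂ _,_ (toWitness c≡c′) (toWitness i≡i′)

nextHalfEdge : State → HalfEdge → HalfEdge
nextHalfEdge s w = smoothStep s (otherEnd w)

touchesWithinᵇ : ℕ → State → HalfEdge → HalfEdge → Bool
touchesWithinᵇ zero    s w h = false
touchesWithinᵇ (suc m) s w h =
  w ==ʰ h ∨ otherEnd w ==ʰ h ∨ touchesWithinᵇ m s (nextHalfEdge s w) h

touchesWithinᵇ-sound : ∀ m s n h → T (touchesWithinᵇ m s (walk s n) h) →
                       ∃[ k ] (walk s k ≡ h ⊎ otherEnd (walk s k) ≡ h)
touchesWithinᵇ-sound (suc m) s n h touches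
  with Equivalence.to (T-∨ {walk s n ==ʰ h}) touches
... | inj₁ here = n , inj₁ (T-==ʰ⇒≡ _ h here)
... | inj₂ rest with Equivalence.to (T-∨ {otherEnd (walk s n) ==ʰ h}) rest
...   | inj₁ here  = n , inj₂ (T-==ʰ⇒≡ _ h here)
...   | inj₂ later = touchesWithinᵇ-sound m s (suc n) h later

connectedWithinᵇ : ℕ → State → Bool
connectedWithinᵇ m s = all-Fin λ c → all-Fin λ i → touchesWithinᵇ m s (walk s 0) (c , i)

connectedWithinᵇ-sound : ∀ m s → T (connectedWithinᵇ m s) → Connected s
connectedWithinᵇ-sound m s t (c , i) = touchesWithinᵇ-sound m s 0 (c , i) (touchesAll c i)
  where
  touches : Fin 4 → Fin 4 → Bool
  touches c i = touchesWithinᵇ m s (walk s 0) (c , i)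

  touchesAll : ∀ c i → T (touches c i)
  touchesAll c = T-all-Fin⇒∀ (touches c) (T-all-Fin⇒∀ (λ c → all-Fin (touches c)) t c)

mutual
  cWinsᵇ : ℕ → Player → Subset 6 → State → Bool
  cWinsᵇ zero    _       sel s = connectedWithinᵇ 8 s
  cWinsᵇ (suc k) playerC sel s = any-Fin (cWinsSelectingᵇ k sel s)
  cWinsᵇ (suc k) playerD sel s = all-Fin (cWinsAgainstᵇ k sel s)

  cWinsSelectingᵇ : ℕ → Subset 6 → State → Region → Bool
  cWinsSelectingᵇ k sel s r =
    not (lookup sel r) ∧ (cWinsAfterᵇ k playerD sel s r false ∨ cWinsAfterᵇ k playerD sel s r true)

  cWinsAgainstᵇ : ℕ → Subset 6 → State → Region → Bool
  cWinsAgainstᵇ k sel s r =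
    lookup sel r ∨ (cWinsAfterᵇ k playerC sel s r false ∧ cWinsAfterᵇ k playerC sel s r true)

  cWinsAfterᵇ : ℕ → Player → Subset 6 → State → Region → Bool → Bool
  cWinsAfterᵇ k p sel s r b = cWinsᵇ k p (⁅ r ⁆ ∪ sel) (applyMove r b s)

cWinsᵇ-sound : ∀ k p sel s → T (cWinsᵇ k p sel s) → CWins k p sel s
cWinsᵇ-sound zero    p       sel s t = connectedWithinᵇ-sound 8 s t
cWinsᵇ-sound (suc k) playerC sel s t with T-any-Fin⇒∃ (cWinsSelectingᵇ k sel s) t
... | r , t′ with Equivalence.to (T-∧ {not (lookup sel r)}) t′
...   | fresh , t″ with Equivalence.to (T-∨ {cWinsAfterᵇ k playerD sel s r false}) t″
...     | inj₁ w = r , T-not-lookup⇒∉ sel r fresh , false , cWinsᵇ-sound k playerD _ _ w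
...     | inj₂ w = r , T-not-lookup⇒∉ sel r fresh , true  , cWinsᵇ-sound k playerD _ _ w
cWinsᵇ-sound (suc k) playerD sel s t r r∉sel b =
  cWinsᵇ-sound k playerC _ _ (T-∧-select (cWinsAfterᵇ k playerC sel s r) b bothWin)
  where
  bothWin : T (cWinsAfterᵇ k playerC sel s r false ∧ cWinsAfterᵇ k playerC sel s r true)
  bothWin = T-∨-resolveˡ (∉⇒lookup≡false sel r r∉sel) (T-all-Fin⇒∀ (cWinsAgainstᵇ k sel s) t r)

walk-cong : ∀ {s t} → s ≗ t → ∀ n → walk s n ≡ walk t n
walk-cong s≗t zero = refl
walk-cong {s} {t} s≗t (suc n) with walk s n | walk-cong s≗t n
... | h | refl with otherEnd h
...   | c , i = cong (λ b → c , smoothArc b i) (s≗t c)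

connected-resp : ∀ {s t} → s ≗ t → Connected s → Connected t
connected-resp s≗t conn h with conn h
... | n , hit = n , subst (λ w → w ≡ h ⊎ otherEnd w ≡ h) (walk-cong s≗t n) hit

applyMove-cong : ∀ {s t} r b → s ≗ t → applyMove r b s ≗ applyMove r b t
applyMove-cong r false s≗t   = s≗t
applyMove-cong r true  s≗t c = cong (_xor lookup (boundary r) c) (s≗t c)

CWins-resp : ∀ {s t} k p sel → s ≗ t → CWins k p sel s → CWins k p sel t
CWins-resp zero    p       sel s≗t w = connected-resp s≗t w
CWins-resp (suc k) playerC sel s≗t (r , r∉sel , b , w) =
  r , r∉sel , b , CWins-resp k playerD _ (applyMove-cong r b s≗t) w
CWins-resp (suc k) playerD sel s≗t w r r∉sel b =
  CWins-resp k playerC _ (applyMove-cong r b s≗t) (w r r∉sel b)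

Board : Bool → Bool → Bool → Bool → State
Board a b c d = lookup (a ∷ b ∷ c ∷ d ∷ [])

-- Stated with ≡ true rather than T: Agda evaluates the former far faster.
winsFromEveryBoard : ∀ a b c d → cWinsᵇ 6 playerD ⊥ (Board a b c d) ≡ true
winsFromEveryBoard false false false false = refl
winsFromEveryBoard false false false true  = refl
winsFromEveryBoard false false true  false = refl
winsFromEveryBoard false false true  true  = refl
winsFromEveryBoard false true  false false = refl
winsFromEveryBoard false true  false true  = refl
winsFromEveryBoard false true  true  false = refl
winsFromEveryBoard false true  true  true  = refl
winsFromEveryBoard true  false false false = refl
winsFromEveryBoard true  false false true  = refl
winsFromEveryBoard true  false true  false = refl
winsFromEveryBoard true  false true  true  = refl
winsFromEveryBoard true  true  false false = refl
winsFromEveryBoard true  true  false true  = refl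
winsFromEveryBoard true  true  true  false = refl
winsFromEveryBoard true  true  true  true  = refl

-- Player C wins from every board, connected or not.
mainTheorem2 : (s : State) → Connected s → CWins 6 playerD ⊥ s
mainTheorem2 s _ = CWins-resp 6 playerD ⊥ (lookup∘tabulate s)
  (cWinsᵇ-sound 6 playerD ⊥ (Board (s c0) (s c1) (s c2) (s c3))
    (Equivalence.from T-≡ (winsFromEveryBoard (s c0) (s c1) (s c2) (s c3))))
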